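{- Let $T$ and $T'$ be finite vertex-colored arborescences, and let $\phi:V(T)\to\{0,\dots,|V(T)|-1\}$ and $\phi':V(T')\to\{0,\dots,|V(T')|-1\}$ be the vertex labelings representing the $\mathrm{L}\mathcal{D}$ orderings of $T$ and $T'$. Then $T$ and $T'$ are isomorphic as vertex-colored arborescences if and only if $\phi^{ -1}\circ\phi'$ and $\phi'^{ -1}\circ\phi$ are color-preserving isomorphisms.
   Context: A vertex-colored arborescence is a finite directed tree $T$ with a root $r$ such that every edge is directed away from $r$, together with a coloring $c:V(T)\to\mathbb{N}$ (not necessarily proper). A vertex-colored (color-preserving) isomorphism is a bijection of vertex sets that maps directed edges exactly onto directed edges and preserves colors. For $v\in V(T)$, $T[v]$ is the subarborescence of $v$ and all its descendants. Arrays are compared lexicographically: $x<y$ iff there is an index $i$ with $x[j]=y[j]$ for all $j<i$ and either $x[i]<y[i]$ (entries being integers or arrays compared recursively), or $x$ has length $i$ while $y$ is longer. The array $\mathrm{L}\mathcal{D}_A$ is defined recursively: if $u$ has no children, $\mathrm{L}\mathcal{D}_A(T[u])=[[\,]]$; otherwise, list the children of $u$ as $n_1,\dots,n_k$ sorted so that $n_a$ precedes $n_b$ whenever $c(n_a)<c(n_b)$, or $c(n_a)=c(n_b)$ and $\mathrm{L}\mathcal{D}_A(T[n_a])<\mathrm{L}\mathcal{D}_A(T[n_b])$ (remaining ties, i.e. siblings of equal color with equal arrays, broken arbitrarily), and set $\mathrm{L}\mathcal{D}_A(T[u])=[[c(n_1),\dots,c(n_k)]]+\mathrm{L}\mathcal{D}_A(T[n_1])+\cdots+\mathrm{L}\mathcal{D}_A(T[n_k])$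 ($+$ is concatenation). The lexicographic depth-first search $\mathrm{L}\mathcal{D}(T)$ is the preorder depth-first traversal of $T$ starting at the root in which the children of every vertex are visited in this sorted order; the labeling $\phi$ representing it assigns to each vertex its position ($0,1,\dots,|V(T)|-1$) in this traversal. -}

module Defs where

open import Data.Nat using (ℕ; zero; suc; _+_; _<_; _<?_)
import Data.Nat.Properties as ℕP
open import Data.Fin using (Fin)
import Data.Fin as F
open import Data.Fin.Permutation using (Permutation′; _⟨$⟩ʳ_)
open import Data.List using (List; []; _∷_; [_]; length; lookup; map; concat; foldr; allFin)
open import Data.Nat.ListAction using (sum)
import Data.List.Properties as LP
open import Data.List.Relation.Binary.Lex.Strict using (Lex-<; <-decidable)
open import Data.Product using (Σ; _×_; _,_; proj₁; proj₂; ∃)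
open import Data.Sum using (_⊎_)
open import Relation.Binary.PropositionalEquality using (_≡_)
open import Relation.Nullary using (Dec; yes; no; ¬_)
open import Relation.Nullary.Decidable using (⌊_⌋)
open import Data.Bool using (if_then_else_)
open import Function.Definitions using (Bijective)
open import Function.Bundles using (_⇔_)

-- Finite vertex-coloured arborescences, as coloured rose trees.
-- `node c ts` is a root of colour c whose children are the roots of ts.
-- (The order of the list ts carries no meaning: isomorphisms and the
-- LD ordering below are defined intrinsically on vertices.)

data Arb : Set where
  node : ℕ → List Arb → Arb

rootColour : Arb → ℕ
rootColour (node c _) = c

-- Vertices V(T): positions in the tree.
data Pos : Arb → Set where
  here  : ∀ {T} → Pos T
  child : ∀ {c ts} (i : Fin (length ts)) → Pos (lookup ts i) → Pos (node c ts)

colour : (T : Arb) → Pos T → ℕ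
colour (node c ts) here        = c
colour (node c ts) (child i p) = colour (lookup ts i) p

data Edge : (T : Arb) → Pos T → Pos T → Set where
  edge-here  : ∀ {c ts} (i : Fin (length ts)) →
               Edge (node c ts) here (child i here)
  edge-child : ∀ {c ts} (i : Fin (length ts)) {u v : Pos (lookup ts i)} →
               Edge (lookup ts i) u v → Edge (node c ts) (child i u) (child i v)

mutual
  size : Arb → ℕ
  size (node c ts) = suc (sizes ts)

  sizes : List Arb → ℕ
  sizes []       = 0
  sizes (t ∷ ts) = size t + sizes ts

IsColIso : (T T' : Arb) → (Pos T → Pos T') → Set
IsColIso T T' f =
  Bijective _≡_ _≡_ f ×
  (∀ u v → Edge T u v ⇔ Edge T' (f u) (f v)) ×
  (∀ v → colour T' (f v) ≡ colour T v)

Isomorphic : Arb → Arb → Set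
Isomorphic T T' = Σ (Pos T → Pos T') (IsColIso T T')

_<ᶜ_ : List ℕ → List ℕ → Set
_<ᶜ_ = Lex-< _≡_ _<_

_<ᴬ_ : List (List ℕ) → List (List ℕ) → Set
_<ᴬ_ = Lex-< _≡_ _<ᶜ_

_<ᶜ?_ : (x y : List ℕ) → Dec (x <ᶜ y)
_<ᶜ?_ = <-decidable ℕP._≟_ _<?_

_<ᴬ?_ : (x y : List (List ℕ)) → Dec (x <ᴬ y)
_<ᴬ?_ = <-decidable (LP.≡-dec ℕP._≟_) _<ᶜ?_

-- sort key of a child n: (c(n), LD_A(T[n])), with the paper's strict order
Key : Set
Key = ℕ × List (List ℕ)

_≺_ : Key → Key → Set
(c , a) ≺ (c' , a') = (c < c') ⊎ ((c ≡ c') × (a <ᴬ a'))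

_≺?_ : (k k' : Key) → Dec (k ≺ k')
(c , a) ≺? (c' , a') with c <? c'
... | yes p = yes (Data.Sum.inj₁ p)
... | no ¬p with c ℕP.≟ c' | a <ᴬ? a'
...   | yes e | yes q = yes (Data.Sum.inj₂ (e , q))
...   | yes e | no ¬q = no λ { (Data.Sum.inj₁ p) → ¬p p ; (Data.Sum.inj₂ (_ , q)) → ¬q q }
...   | no ¬e | _     = no λ { (Data.Sum.inj₁ p) → ¬p p ; (Data.Sum.inj₂ (e , _)) → ¬e e }

-- insertion sort into ≺-nondecreasing order (keys that tie are equal,
-- so the result does not depend on how ties are broken)
insertKey : Key → List Key → List Key
insertKey k []        = [ k ]
insertKey k (k' ∷ ks) with k' ≺? k
... | yes _ = k' ∷ insertKey k ks
... | no  _ = k ∷ k' ∷ ks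

sortKeys : List Key → List Key
sortKeys = foldr insertKey []

-- LD_A(T[u]) = [[c(n₁),…,c(n_k)]] + LD_A(T[n₁]) + ⋯ + LD_A(T[n_k]);
-- for a leaf (k = 0) this is [[ ]].
mutual
  ldA : Arb → List (List ℕ)
  ldA (node c ts) = let ks = sortKeys (keysOf ts) in
                    map proj₁ ks ∷ concat (map proj₂ ks)

  keysOf : List Arb → List Key
  keysOf []       = []
  keysOf (t ∷ ts) = (rootColour t , ldA t) ∷ keysOf ts

key : Arb → Key
key t = (rootColour t , ldA t)

-- Depth-first orderings.  An arrangement fixes, at every vertex, the order
-- in which its children are visited: `pos i` is the position of child i.

data Arrangement : Arb → Set where
  arr : ∀ {c ts} → (pos : Permutation′ (length ts)) →
        ((i : Fin (length ts)) → Arrangement (lookup ts i)) →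
        Arrangement (node c ts)

LDSorted : (T : Arb) → Arrangement T → Set
LDSorted (node c ts) (arr pos sub) =
  (∀ i j → key (lookup ts i) ≺ key (lookup ts j) →
           F.toℕ (pos ⟨$⟩ʳ i) < F.toℕ (pos ⟨$⟩ʳ j)) ×
  (∀ i → LDSorted (lookup ts i) (sub i))

-- preorder position of each vertex in the depth-first traversal that
-- visits children in the order given by the arrangement
preorder : (T : Arb) → Arrangement T → Pos T → ℕ
preorder (node c ts) (arr pos sub) here = 0
preorder (node c ts) (arr pos sub) (child i p) =
  suc (sum (map (λ j → if ⌊ F.toℕ (pos ⟨$⟩ʳ j) <? F.toℕ (pos ⟨$⟩ʳ i) ⌋
                         then size (lookup ts j) else 0)
                (allFin (length ts)))
       + preorder (lookup ts i) (sub i) p)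

-- φ is a labeling representing an LD ordering of T (the labels are the
-- positions 0,…,|V(T)|-1 in the traversal)
IsLDLabeling : (T : Arb) → (Pos T → ℕ) → Set
IsLDLabeling T φ =
  Σ (Arrangement T) λ a → LDSorted T a × (∀ v → φ v ≡ preorder T a v)

-- "φ⁻¹ ∘ φ' is a colour-preserving isomorphism V(T') → V(T)":
-- the (unique, as φ is injective) map f with φ ∘ f = φ' exists and is a
-- colour-preserving isomorphism.
InvComposeIsIso : (T T' : Arb) → (Pos T → ℕ) → (Pos T' → ℕ) → Set
InvComposeIsIso T T' φ φ' =
  Σ (Pos T' → Pos T) λ f → (∀ v → φ (f v) ≡ φ' v) × IsColIso T' T f

{-# OPTIONS --safe #-}
-- The key (root colour, LD_A) is a complete invariant of coloured arborescences, and an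
-- LD-sorted traversal is determined by it.  An isomorphism permutes the children of each
-- vertex, so by induction from the leaves the lists of child keys at corresponding vertices
-- are permutations of each other and sort to the same list, which is all that LD_A records.
-- Conversely LD_A is uniquely readable, so equal keys give equal sorted lists of child keys.
-- An LD-sorted arrangement visits the children in exactly that sorted order, which matches
-- the children of the two roots rank by rank; gluing the recursively obtained isomorphisms
-- of matched subtrees gives a colour isomorphism f with preorder ∘ f = preorder', i.e.
-- φ ∘ f = φ'.

module Submission where

open import Defs
open import Data.Bool using (if_then_else_)
open import Data.Empty using (⊥-elim)
open import Data.Fin using (Fin; zero; suc; toℕ; cast; punchIn)
import Data.Fin as F
open import Data.Fin.Permutation
  using (Permutation; Permutation′; permutation; _⟨$⟩ʳ_; _⟨$⟩ˡ_; inverseˡ; inverseʳ; flip; _∘ₚ_;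
         cast-id; remove; punchIn-permute)
open import Data.Fin.Properties using (¬Fin0; toℕ-cast; cast-involutive)
open import Data.List using (List; []; _∷_; _++_; length; map; concat; tabulate; lookup; allFin)
open import Data.List.Properties
  using (∷-injective; ∷-injectiveˡ; ∷-injectiveʳ; ++-assoc; length-++; map-∘;
         tabulate-cong; map-tabulate)
open import Data.List.Relation.Binary.Lex.Strict using (Lex-<; <-compare; <-transitive)
open import Data.List.Relation.Binary.Permutation.Propositional
  using (_↭_; ↭-refl; ↭-prep; ↭-swap; ↭-sym; ↭-trans; ↭-reflexive; ↭⇒↭ₛ; module PermutationReasoning)
open import Data.List.Relation.Binary.Permutation.Propositional.Properties using (All-resp-↭; map⁺)
open import Data.List.Relation.Binary.Pointwise using (Pointwise-≡⇒≡; ≡⇒Pointwise-≡)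
open import Data.List.Relation.Unary.All using (All; []; _∷_)
open import Data.List.Relation.Unary.AllPairs.Properties using (tabulate⁺-<)
open import Data.List.Relation.Unary.Linked.Properties using (AllPairs⇒Linked)
open import Data.Nat using (ℕ; zero; suc; _+_; _<_; _<?_)
open import Data.Nat.ListAction using (sum)
open import Data.Nat.ListAction.Properties using (sum-↭)
import Data.Nat.Properties as ℕ
open import Data.Product using (Σ; ∃; _×_; _,_; proj₁; proj₂)
open import Data.Product.Relation.Binary.Lex.Strict using (×-compare; ×-transitive)
open import Data.Product.Relation.Binary.Pointwise.NonDependent using (≡×≡⇒≡; ≡⇒≡×≡)
open import Data.Sum using (_⊎_; inj₁; inj₂)
open import Function using (_∘_; id)
open import Function.Bundles using (_⇔_; Equivalence; mk⇔; Injection)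
open import Function.Consequences.Propositional using (strictlySurjective⇒surjective)
open import Function.Definitions using (StrictlySurjective)
open import Function.Properties.Inverse using (↔⇒↣)
open import Level using (0ℓ)
open import Relation.Binary
  using (Rel; _⇒_; Transitive; Trichotomous; tri<; tri≈; tri>; DecTotalOrder)
open import Relation.Binary.Consequences using (tri⇒irr; tri⇒dec≈)
open import Relation.Binary.PropositionalEquality
  using (_≡_; refl; sym; trans; cong; cong₂; subst; subst₂; isEquivalence; resp₂; module ≡-Reasoning)
open import Relation.Nullary using (yes; no; ¬_; ¬?; contradiction)
open import Relation.Nullary.Decidable using (⌊_⌋)

-- The order on keys and sorting

≡-compare : ∀ {A : Set} {_≈_ _<_ : Rel A 0ℓ} →
            _≈_ ⇒ _≡_ → _≡_ ⇒ _≈_ → Trichotomous _≈_ _<_ → Trichotomous _≡_ _<_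
≡-compare ≈⇒≡ ≡⇒≈ compare x y with compare x y
... | tri< x<y x≉y y≮x = tri< x<y (x≉y ∘ ≡⇒≈) y≮x
... | tri≈ x≮y x≈y y≮x = tri≈ x≮y (≈⇒≡ x≈y) y≮x
... | tri> x≮y x≉y y<x = tri> x≮y (x≉y ∘ ≡⇒≈) y<x

lex-compare : ∀ {A : Set} {_<_ : Rel A 0ℓ} → Trichotomous _≡_ _<_ → Trichotomous _≡_ (Lex-< _≡_ _<_)
lex-compare compare = ≡-compare Pointwise-≡⇒≡ ≡⇒Pointwise-≡ (<-compare sym compare)

lex-trans : ∀ {A : Set} {_<_ : Rel A 0ℓ} → Transitive _<_ → Transitive (Lex-< _≡_ _<_)
lex-trans = <-transitive isEquivalence (resp₂ _)

≺-compare : Trichotomous _≡_ _≺_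
≺-compare = ≡-compare ≡×≡⇒≡ ≡⇒≡×≡ (×-compare sym ℕ.<-cmp (lex-compare (lex-compare ℕ.<-cmp)))

≺-trans : Transitive _≺_
≺-trans =
  ×-transitive {_<₂_ = _<ᴬ_} isEquivalence (resp₂ _<_) ℕ.<-trans (lex-trans (lex-trans ℕ.<-trans))

-- With this order (rather than ≺ ⊎ ≡) the library's insertion sort makes exactly the
-- comparisons of insertKey.
_≼_ : Rel Key 0ℓ
k ≼ k' = ¬ (k' ≺ k)

≼-decTotalOrder : DecTotalOrder 0ℓ 0ℓ 0ℓ
≼-decTotalOrder = record
  { isDecTotalOrder = record
    { isTotalOrder = record
      { isPartialOrder = record
        { isPreorder = record
          { isEquivalence = isEquivalence
          ; reflexive     = λ { refl → tri⇒irr ≺-compare refl }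
          ; trans         = ≼-trans
          }
        ; antisym = ≼-antisym
        }
      ; total = ≼-total
      }
    ; _≟_  = tri⇒dec≈ ≺-compare
    ; _≤?_ = λ k k' → ¬? (k' ≺? k)
    }
  }
  where
  ≼-trans : Transitive _≼_
  ≼-trans {k} {l} l⊀k m⊀l m≺k with ≺-compare k l
  ... | tri< k≺l _ _ = m⊀l (≺-trans m≺k k≺l)
  ... | tri≈ _ refl _ = m⊀l m≺k
  ... | tri> _ _ l≺k = l⊀k l≺k

  ≼-antisym : ∀ {k l} → k ≼ l → l ≼ k → k ≡ l
  ≼-antisym {k} {l} l⊀k k⊀l with ≺-compare k l
  ... | tri< k≺l _ _ = contradiction k≺l k⊀l
  ... | tri≈ _ k≡l _ = k≡l
  ... | tri> _ _ l≺k = contradiction l≺k l⊀k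

  ≼-total : ∀ k l → k ≼ l ⊎ l ≼ k
  ≼-total k l with ≺-compare k l
  ... | tri< _ _ l⊀k = inj₁ l⊀k
  ... | tri≈ _ _ l⊀k = inj₁ l⊀k
  ... | tri> k⊀l _ _ = inj₂ k⊀l

open DecTotalOrder ≼-decTotalOrder using (totalOrder)
open import Data.List.Sort.InsertionSort.Base ≼-decTotalOrder using (insert; sort)
open import Data.List.Sort.InsertionSort.Properties ≼-decTotalOrder using (sort-↭; sort-↗)
open import Data.List.Relation.Unary.Sorted.TotalOrder totalOrder using (Sorted)
open import Data.List.Relation.Unary.Sorted.TotalOrder.Properties using (↗↭↗⇒≋)

insertKey≡insert : ∀ k ks → insertKey k ks ≡ insert k ks
insertKey≡insert k []        = refl
insertKey≡insert k (k' ∷ ks) with k' ≺? k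
... | yes _ = cong (k' ∷_) (insertKey≡insert k ks)
... | no  _ = refl

sortKeys≡sort : ∀ ks → sortKeys ks ≡ sort ks
sortKeys≡sort []       = refl
sortKeys≡sort (k ∷ ks) = trans (cong (insertKey k) (sortKeys≡sort ks)) (insertKey≡insert k (sort ks))

sortKeys-↭ : ∀ ks → sortKeys ks ↭ ks
sortKeys-↭ ks rewrite sortKeys≡sort ks = sort-↭ ks

sortKeys-↗ : ∀ ks → Sorted (sortKeys ks)
sortKeys-↗ ks rewrite sortKeys≡sort ks = sort-↗ ks

↗↭↗⇒≡ : ∀ {ks ls} → Sorted ks → Sorted ls → ks ↭ ls → ks ≡ ls
↗↭↗⇒≡ ks↗ ls↗ ks↭ls = Pointwise-≡⇒≡ (↗↭↗⇒≋ totalOrder ks↗ ls↗ (↭⇒↭ₛ ks↭ls))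

↗↭⇒≡sortKeys : ∀ {ks ls} → Sorted ks → ks ↭ ls → ks ≡ sortKeys ls
↗↭⇒≡sortKeys {ks} {ls} ks↗ ks↭ls = ↗↭↗⇒≡ ks↗ (sortKeys-↗ ls) (↭-trans ks↭ls (↭-sym (sortKeys-↭ ls)))

sortKeys-cong-↭ : ∀ {ks ls} → ks ↭ ls → sortKeys ks ≡ sortKeys ls
sortKeys-cong-↭ {ks} ks↭ls = ↗↭⇒≡sortKeys (sortKeys-↗ ks) (↭-trans (sortKeys-↭ ks) ks↭ls)

-- Unique readability of LD arrays

assemble : List Key → List (List ℕ)
assemble ks = map proj₁ ks ∷ concat (map proj₂ ks)

-- The grammar of LD arrays: the head of an array lists the children's colours and so
-- fixes how many sub-arrays follow.
data Readable : List (List ℕ) → Set where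
  assembled : ∀ ks → All (Readable ∘ proj₂) ks → Readable (assemble ks)

mutual
  assemble-++-injective : ∀ {ks ks' r r'} →
    All (Readable ∘ proj₂) ks → All (Readable ∘ proj₂) ks' →
    assemble ks ++ r ≡ assemble ks' ++ r' → ks ≡ ks' × r ≡ r'
  assemble-++-injective rs rs' e = concat-++-injective rs rs' (∷-injectiveˡ e) (∷-injectiveʳ e)

  concat-++-injective : ∀ {ks ks' r r'} →
    All (Readable ∘ proj₂) ks → All (Readable ∘ proj₂) ks' →
    map proj₁ ks ≡ map proj₁ ks' →
    concat (map proj₂ ks) ++ r ≡ concat (map proj₂ ks') ++ r' → ks ≡ ks' × r ≡ r'
  concat-++-injective [] [] _ e = refl , e
  concat-++-injective [] (_ ∷ _) () _
  concat-++-injective (_ ∷ _) [] () _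
  concat-++-injective {(_ , _) ∷ ks} {(_ , _) ∷ ks'} {r} {r'}
                      (assembled js rjs ∷ rs) (assembled js' rjs' ∷ rs') hd e
    with ∷-injective hd
  ... | refl , hds
    with assemble-++-injective rjs rjs'
           (trans (sym (++-assoc (assemble js) _ r)) (trans e (++-assoc (assemble js') _ r')))
  ... | refl , tails with concat-++-injective rs rs' hds tails
  ... | refl , r≡r' = refl , r≡r'

mutual
  ldA-readable : ∀ t → Readable (ldA t)
  ldA-readable (node _ ts) = assembled _ (sortedKeysOf-readable ts)

  sortedKeysOf-readable : ∀ ts → All (Readable ∘ proj₂) (sortKeys (keysOf ts))
  sortedKeysOf-readable ts = All-resp-↭ (↭-sym (sortKeys-↭ (keysOf ts))) (keysOf-readable ts)

  keysOf-readable : ∀ ts → All (Readable ∘ proj₂) (keysOf ts)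
  keysOf-readable []       = []
  keysOf-readable (t ∷ ts) = ldA-readable t ∷ keysOf-readable ts

assemble-injective : ∀ {ks ks'} → All (Readable ∘ proj₂) ks → All (Readable ∘ proj₂) ks' →
                     assemble ks ≡ assemble ks' → ks ≡ ks'
assemble-injective rs rs' e = proj₁ (assemble-++-injective rs rs' (cong (_++ []) e))

length-concat : ∀ {A : Set} (xss : List (List A)) → length (concat xss) ≡ sum (map length xss)
length-concat []         = refl
length-concat (xs ∷ xss) = trans (length-++ xs) (cong (length xs +_) (length-concat xss))

mutual
  size≡length-ldA : ∀ t → size t ≡ length (ldA t)
  size≡length-ldA (node _ ts) = cong suc (begin
    sizes ts                                ≡⟨ sizes≡ ts ⟩
    sum (map (length ∘ proj₂) (keysOf ts))  ≡⟨ sum-↭ (map⁺ _ (sortKeys-↭ (keysOf ts))) ⟨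
    sum (map (length ∘ proj₂) ks)           ≡⟨ cong sum (map-∘ ks) ⟩
    sum (map length (map proj₂ ks))         ≡⟨ length-concat (map proj₂ ks) ⟨
    length (concat (map proj₂ ks))          ∎)
    where
    open ≡-Reasoning
    ks : List Key
    ks = sortKeys (keysOf ts)

  sizes≡ : ∀ ts → sizes ts ≡ sum (map (length ∘ proj₂) (keysOf ts))
  sizes≡ []       = refl
  sizes≡ (t ∷ ts) = cong₂ _+_ (size≡length-ldA t) (sizes≡ ts)

key-size : ∀ {t t'} → key t ≡ key t' → size t ≡ size t'
key-size {t} {t'} e =
  trans (size≡length-ldA t) (trans (cong (length ∘ proj₂) e) (sym (size≡length-ldA t')))

-- Permuted tabulations

module _ {A : Set} where

  tabulate-↭-punchIn : ∀ {n} (g : Fin (suc n) → A) (k : Fin (suc n)) →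
                       tabulate g ↭ g k ∷ tabulate (g ∘ punchIn k)
  tabulate-↭-punchIn         g zero    = ↭-refl
  tabulate-↭-punchIn {suc n} g (suc k) =
    ↭-trans (↭-prep (g zero) (tabulate-↭-punchIn (g ∘ suc) k)) (↭-swap (g zero) (g (suc k)) ↭-refl)

  tabulate-∘-↭ : ∀ {m n} (π : Permutation m n) (g : Fin n → A) → tabulate (g ∘ (π ⟨$⟩ʳ_)) ↭ tabulate g
  tabulate-∘-↭ {zero}  {zero}  π g = ↭-refl
  tabulate-∘-↭ {zero}  {suc n} π g = ⊥-elim (¬Fin0 (π ⟨$⟩ˡ zero))
  tabulate-∘-↭ {suc m} {zero}  π g = ⊥-elim (¬Fin0 (π ⟨$⟩ʳ zero))
  tabulate-∘-↭ {suc m} {suc n} π g = begin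
    g k ∷ tabulate (g ∘ (π ⟨$⟩ʳ_) ∘ suc)
      ≡⟨ cong (g k ∷_) (tabulate-cong (cong g ∘ punchIn-permute π zero)) ⟩
    g k ∷ tabulate (g ∘ punchIn k ∘ (remove zero π ⟨$⟩ʳ_))
      ↭⟨ ↭-prep (g k) (tabulate-∘-↭ (remove zero π) (g ∘ punchIn k)) ⟩
    g k ∷ tabulate (g ∘ punchIn k)
      ↭⟨ tabulate-↭-punchIn g k ⟨
    tabulate g
      ∎
    where
    open PermutationReasoning
    k : Fin (suc n)
    k = π ⟨$⟩ʳ zero

  tabulate-injective : ∀ {m n} (f : Fin m → A) (g : Fin n → A) → tabulate f ≡ tabulate g →
                       Σ (m ≡ n) λ m≡n → ∀ i → f i ≡ g (cast m≡n i)
  tabulate-injective {zero}  {zero}  f g e  = refl , λ ()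
  tabulate-injective {suc m} {suc n} f g e with tabulate-injective (f ∘ suc) (g ∘ suc) (∷-injectiveʳ e)
  ... | m≡n , f≗g = cong suc m≡n , λ { zero → ∷-injectiveˡ e ; (suc i) → f≗g i }

  align : ∀ {m n} (f : Fin m → A) (g : Fin n → A) (ρ : Permutation′ m) (ρ' : Permutation′ n) →
          tabulate (f ∘ (ρ ⟨$⟩ˡ_)) ≡ tabulate (g ∘ (ρ' ⟨$⟩ˡ_)) →
          Σ (Permutation n m) λ σ → (∀ i → f (σ ⟨$⟩ʳ i) ≡ g i) ×
                                     (∀ i → toℕ (ρ ⟨$⟩ʳ (σ ⟨$⟩ʳ i)) ≡ toℕ (ρ' ⟨$⟩ʳ i))
  align {m} {n} f g ρ ρ' e with tabulate-injective _ _ e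
  ... | m≡n , f≗g = σ , f∘σ≗g , ρ∘σ≗ρ'
    where
    σ : Permutation n m
    σ = ρ' ∘ₚ cast-id (sym m≡n) ∘ₚ flip ρ

    f∘σ≗g : ∀ i → f (σ ⟨$⟩ʳ i) ≡ g i
    f∘σ≗g i = begin
      f (ρ ⟨$⟩ˡ cast (sym m≡n) (ρ' ⟨$⟩ʳ i))
        ≡⟨ f≗g _ ⟩
      g (ρ' ⟨$⟩ˡ cast m≡n (cast (sym m≡n) (ρ' ⟨$⟩ʳ i)))
        ≡⟨ cong (g ∘ (ρ' ⟨$⟩ˡ_)) (cast-involutive m≡n (sym m≡n) _) ⟩
      g (ρ' ⟨$⟩ˡ (ρ' ⟨$⟩ʳ i))
        ≡⟨ cong g (inverseˡ ρ') ⟩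
      g i
        ∎
      where open ≡-Reasoning

    ρ∘σ≗ρ' : ∀ i → toℕ (ρ ⟨$⟩ʳ (σ ⟨$⟩ʳ i)) ≡ toℕ (ρ' ⟨$⟩ʳ i)
    ρ∘σ≗ρ' i = trans (cong toℕ (inverseʳ ρ)) (toℕ-cast (sym m≡n) (ρ' ⟨$⟩ʳ i))

Ranks : ∀ {n} → (Fin n → Key) → Permutation′ n → Set
Ranks f ρ = ∀ i j → f i ≺ f j → toℕ (ρ ⟨$⟩ʳ i) < toℕ (ρ ⟨$⟩ʳ j)

ranks⇒≡sortKeys : ∀ {n} (f : Fin n → Key) (ρ : Permutation′ n) → Ranks f ρ →
                  tabulate (f ∘ (ρ ⟨$⟩ˡ_)) ≡ sortKeys (tabulate f)
ranks⇒≡sortKeys f ρ ranks =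
  ↗↭⇒≡sortKeys (AllPairs⇒Linked (tabulate⁺-< in-order)) (tabulate-∘-↭ (flip ρ) f)
  where
  in-order : ∀ {k l} → k F.< l → f (ρ ⟨$⟩ˡ k) ≼ f (ρ ⟨$⟩ˡ l)
  in-order k<l fl≺fk =
    ℕ.<-asym k<l (subst₂ (λ a b → toℕ a < toℕ b) (inverseʳ ρ) (inverseʳ ρ) (ranks _ _ fl≺fk))

keysOf≡tabulate : ∀ ts → keysOf ts ≡ tabulate (key ∘ lookup ts)
keysOf≡tabulate []       = refl
keysOf≡tabulate (t ∷ ts) = cong (key t ∷_) (keysOf≡tabulate ts)

-- Vertices, children and isomorphisms

subtree : (T : Arb) → Pos T → Arb
subtree T           here        = T
subtree (node _ ts) (child i p) = subtree (lookup ts i) p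

arity : (T : Arb) → Pos T → ℕ
arity (node _ ts) here        = length ts
arity (node _ ts) (child i p) = arity (lookup ts i) p

childAt : (T : Arb) (u : Pos T) → Fin (arity T u) → Pos T
childAt (node _ ts) here        i = child i here
childAt (node _ ts) (child j p) i = child j (childAt (lookup ts j) p i)

key-subtree : ∀ T u → key (subtree T u) ≡
              (colour T u , assemble (sortKeys (tabulate (λ i → key (subtree T (childAt T u i))))))
key-subtree (node c ts) here        = cong (λ ks → c , assemble (sortKeys ks)) (keysOf≡tabulate ts)
key-subtree (node _ ts) (child i p) = key-subtree (lookup ts i) p

mutual
  childAt-ind : ∀ T (P : Pos T → Set) → (∀ u → (∀ i → P (childAt T u i)) → P u) → ∀ u → P u
  childAt-ind (node _ ts) P step here        =
    step here λ i → lookup-childAt-ind ts i (P ∘ child i) (step ∘ child i) here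
  childAt-ind (node _ ts) P step (child i u) = lookup-childAt-ind ts i (P ∘ child i) (step ∘ child i) u

  lookup-childAt-ind : ∀ ts i (P : Pos (lookup ts i) → Set) →
                       (∀ u → (∀ j → P (childAt (lookup ts i) u j)) → P u) → ∀ u → P u
  lookup-childAt-ind (t ∷ _)  zero    = childAt-ind t
  lookup-childAt-ind (_ ∷ ts) (suc i) = lookup-childAt-ind ts i

childAt-edge : ∀ T u i → Edge T u (childAt T u i)
childAt-edge (node _ ts) here        i = edge-here i
childAt-edge (node _ ts) (child j p) i = edge-child j (childAt-edge (lookup ts j) p i)

edge⇒childAt : ∀ {T u v} → Edge T u v → ∃ λ i → v ≡ childAt T u i
edge⇒childAt (edge-here i)    = i , refl
edge⇒childAt (edge-child j e) = let (i , v≡) = edge⇒childAt e in i , cong (child j) v≡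

child-index-injective : ∀ {c ts i j} {p : Pos (lookup ts i)} {q : Pos (lookup ts j)} →
                        child {c} {ts} i p ≡ child j q → i ≡ j
child-index-injective refl = refl

child-injective : ∀ {c ts i} {p q : Pos (lookup ts i)} → child {c} {ts} i p ≡ child i q → p ≡ q
child-injective refl = refl

childAt-injective : ∀ T u {i j} → childAt T u i ≡ childAt T u j → i ≡ j
childAt-injective (node _ ts) here        e = child-index-injective e
childAt-injective (node _ ts) (child k p) e = childAt-injective (lookup ts k) p (child-injective e)

root-or-child : ∀ {T} (v : Pos T) → v ≡ here ⊎ ∃ λ u → Edge T u v
root-or-child here        = inj₁ refl
root-or-child (child i v) with root-or-child v
... | inj₁ refl     = inj₂ (here , edge-here i)
... | inj₂ (u , e) = inj₂ (child i u , edge-child i e)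

edge-here⁻¹ : ∀ {c ts i} {p : Pos (lookup ts i)} → Edge (node c ts) here (child i p) → p ≡ here
edge-here⁻¹ (edge-here _) = refl

edge-child-index : ∀ {c ts i j} {p : Pos (lookup ts i)} {q : Pos (lookup ts j)} →
                   Edge (node c ts) (child i p) (child j q) → i ≡ j
edge-child-index (edge-child _ _) = refl

edge-child⁻¹ : ∀ {c ts i} {p q : Pos (lookup ts i)} →
               Edge (node c ts) (child i p) (child i q) → Edge (lookup ts i) p q
edge-child⁻¹ (edge-child _ e) = e

module ColIso {T T' : Arb} {h : Pos T → Pos T'} (iso : IsColIso T T' h) where

  injective : ∀ {u v} → h u ≡ h v → u ≡ v
  injective = proj₁ (proj₁ iso)

  surjective : StrictlySurjective _≡_ h
  surjective y = let (x , hx≡y) = proj₂ (proj₁ iso) y in x , hx≡y refl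

  preserves-edges : ∀ u v → Edge T u v ⇔ Edge T' (h u) (h v)
  preserves-edges = proj₁ (proj₂ iso)

  preserves-colour : ∀ v → colour T' (h v) ≡ colour T v
  preserves-colour = proj₂ (proj₂ iso)

  private
    h⁻¹ : Pos T' → Pos T
    h⁻¹ = proj₁ ∘ surjective

    h∘h⁻¹ : ∀ y → h (h⁻¹ y) ≡ y
    h∘h⁻¹ = proj₂ ∘ surjective

    reflect-edge : ∀ {u y} → Edge T' (h u) y → Edge T u (h⁻¹ y)
    reflect-edge {u} {y} e =
      Equivalence.from (preserves-edges u (h⁻¹ y)) (subst (Edge T' (h u)) (sym (h∘h⁻¹ y)) e)

  root : h here ≡ here
  root with root-or-child (h here)
  ... | inj₁ h-here≡here = h-here≡here
  ... | inj₂ (y , e)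
    with Equivalence.from (preserves-edges (h⁻¹ y) here)
                          (subst (λ x → Edge T' x (h here)) (sym (h∘h⁻¹ y)) e)
  ... | ()

  children : ∀ u → Σ (Permutation (arity T u) (arity T' (h u))) λ τ →
                   ∀ i → h (childAt T u i) ≡ childAt T' (h u) (τ ⟨$⟩ʳ i)
  children u = permutation τ τ⁻¹ τ∘τ⁻¹ τ⁻¹∘τ , proj₂ ∘ forth
    where
    forth : ∀ i → ∃ λ j → h (childAt T u i) ≡ childAt T' (h u) j
    forth i = edge⇒childAt (Equivalence.to (preserves-edges u _) (childAt-edge T u i))

    back : ∀ j → ∃ λ i → h⁻¹ (childAt T' (h u) j) ≡ childAt T u i
    back j = edge⇒childAt (reflect-edge (childAt-edge T' (h u) j))

    τ : Fin (arity T u) → Fin (arity T' (h u))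
    τ = proj₁ ∘ forth

    τ⁻¹ : Fin (arity T' (h u)) → Fin (arity T u)
    τ⁻¹ = proj₁ ∘ back

    τ⁻¹∘τ : ∀ i → τ⁻¹ (τ i) ≡ i
    τ⁻¹∘τ i = childAt-injective T u (injective (begin
      h (childAt T u (τ⁻¹ (τ i)))     ≡⟨ cong h (proj₂ (back (τ i))) ⟨
      h (h⁻¹ (childAt T' (h u) (τ i))) ≡⟨ h∘h⁻¹ _ ⟩
      childAt T' (h u) (τ i)           ≡⟨ proj₂ (forth i) ⟨
      h (childAt T u i)                ∎))
      where open ≡-Reasoning

    τ∘τ⁻¹ : ∀ j → τ (τ⁻¹ j) ≡ j
    τ∘τ⁻¹ j = childAt-injective T' (h u) (begin
      childAt T' (h u) (τ (τ⁻¹ j))   ≡⟨ proj₂ (forth (τ⁻¹ j)) ⟨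
      h (childAt T u (τ⁻¹ j))         ≡⟨ cong h (proj₂ (back j)) ⟨
      h (h⁻¹ (childAt T' (h u) j))    ≡⟨ h∘h⁻¹ _ ⟩
      childAt T' (h u) j              ∎)
      where open ≡-Reasoning

  preserves-key : ∀ u → key (subtree T u) ≡ key (subtree T' (h u))
  preserves-key = childAt-ind T _ step
    where
    step : ∀ u → (∀ i → key (subtree T (childAt T u i)) ≡ key (subtree T' (h (childAt T u i)))) →
           key (subtree T u) ≡ key (subtree T' (h u))
    step u ih = begin
      key (subtree T u)
        ≡⟨ key-subtree T u ⟩
      colour T u , assemble (sortKeys (tabulate (λ i → key (subtree T (childAt T u i)))))
        ≡⟨ cong₂ (λ c ks → c , assemble ks) (sym (preserves-colour u)) (sortKeys-cong-↭ child-keys-↭) ⟩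
      colour T' (h u) , assemble (sortKeys (tabulate (λ j → key (subtree T' (childAt T' (h u) j)))))
        ≡⟨ key-subtree T' (h u) ⟨
      key (subtree T' (h u))
        ∎
      where
      open ≡-Reasoning
      child-keys-↭ : tabulate (λ i → key (subtree T (childAt T u i))) ↭
                     tabulate (λ j → key (subtree T' (childAt T' (h u) j)))
      child-keys-↭ with children u
      ... | τ , h∘childAt≗childAt∘τ = ↭-trans
        (↭-reflexive (tabulate-cong λ i →
          trans (ih i) (cong (key ∘ subtree T') (h∘childAt≗childAt∘τ i))))
        (tabulate-∘-↭ τ _)

iso⇒key≡ : ∀ {T T'} → Isomorphic T T' → key T ≡ key T'
iso⇒key≡ {T' = T'} (h , iso) =
  trans (ColIso.preserves-key iso here) (cong (key ∘ subtree T') (ColIso.root iso))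

-- Gluing isomorphisms of children

-- The summand that preorder adds at child i: the sizes of the siblings visited before i.
offset : (ts : List Arb) → Permutation′ (length ts) → Fin (length ts) → ℕ
offset ts pos i =
  sum (map (λ j → if ⌊ toℕ (pos ⟨$⟩ʳ j) <? toℕ (pos ⟨$⟩ʳ i) ⌋ then size (lookup ts j) else 0)
           (allFin (length ts)))

offset-reindex : ∀ {ts ts'} {pos : Permutation′ (length ts)} {pos' : Permutation′ (length ts')}
  (σ : Permutation (length ts') (length ts)) →
  (∀ i' → toℕ (pos ⟨$⟩ʳ (σ ⟨$⟩ʳ i')) ≡ toℕ (pos' ⟨$⟩ʳ i')) →
  (∀ i' → size (lookup ts (σ ⟨$⟩ʳ i')) ≡ size (lookup ts' i')) →
  ∀ i' → offset ts pos (σ ⟨$⟩ʳ i') ≡ offset ts' pos' i'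
offset-reindex {ts} {ts'} {pos} {pos'} σ pos∘σ≗pos' size∘σ≗size i' = begin
  sum (map earlier (allFin _))         ≡⟨ cong sum (map-tabulate id earlier) ⟩
  sum (tabulate earlier)               ≡⟨ sum-↭ (tabulate-∘-↭ σ earlier) ⟨
  sum (tabulate (earlier ∘ (σ ⟨$⟩ʳ_))) ≡⟨ cong sum (tabulate-cong earlier∘σ≗earlier') ⟩
  sum (tabulate earlier')              ≡⟨ cong sum (map-tabulate id earlier') ⟨
  sum (map earlier' (allFin _))        ∎
  where
  open ≡-Reasoning
  earlier : Fin (length ts) → ℕ
  earlier j = if ⌊ toℕ (pos ⟨$⟩ʳ j) <? toℕ (pos ⟨$⟩ʳ (σ ⟨$⟩ʳ i')) ⌋ then size (lookup ts j) else 0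
  earlier' : Fin (length ts') → ℕ
  earlier' j' = if ⌊ toℕ (pos' ⟨$⟩ʳ j') <? toℕ (pos' ⟨$⟩ʳ i') ⌋ then size (lookup ts' j') else 0
  earlier∘σ≗earlier' : ∀ j' → earlier (σ ⟨$⟩ʳ j') ≡ earlier' j'
  earlier∘σ≗earlier' j' rewrite pos∘σ≗pos' j' | pos∘σ≗pos' i' | size∘σ≗size j' = refl

permutation-injective : ∀ {m n} (σ : Permutation m n) {i j} → σ ⟨$⟩ʳ i ≡ σ ⟨$⟩ʳ j → i ≡ j
permutation-injective σ = Injection.injective (↔⇒↣ σ)

module Glue {c c' : ℕ} {ts ts' : List Arb} (σ : Permutation (length ts') (length ts))
            (fs : ∀ i' → Pos (lookup ts' i') → Pos (lookup ts (σ ⟨$⟩ʳ i'))) where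

  glue : Pos (node c' ts') → Pos (node c ts)
  glue here         = here
  glue (child i' p) = child (σ ⟨$⟩ʳ i') (fs i' p)

  module _ (c≡c' : c ≡ c')
           (isos : ∀ i' → IsColIso (lookup ts' i') (lookup ts (σ ⟨$⟩ʳ i')) (fs i')) where

    private
      module Iso i' = ColIso (isos i')

    glue-injective : ∀ {u v} → glue u ≡ glue v → u ≡ v
    glue-injective {here}       {here}       _ = refl
    glue-injective {child i' p} {child j' q} e with permutation-injective σ (child-index-injective e)
    ... | refl = cong (child i') (Iso.injective i' (child-injective e))

    glue-surjective : StrictlySurjective _≡_ glue
    glue-surjective here        = here , refl
    glue-surjective (child j q) = reach (σ ⟨$⟩ˡ j) (inverseʳ σ) q
      where
      reach : ∀ i' {j} → σ ⟨$⟩ʳ i' ≡ j → (q : Pos (lookup ts j)) → ∃ λ v → glue v ≡ child j q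
      reach i' refl q = let (p , fp≡q) = Iso.surjective i' q in child i' p , cong (child _) fp≡q

    glue-edge : ∀ {u v} → Edge (node c' ts') u v → Edge (node c ts) (glue u) (glue v)
    glue-edge (edge-here i') =
      subst (Edge (node c ts) here ∘ child (σ ⟨$⟩ʳ i')) (sym (Iso.root i')) (edge-here (σ ⟨$⟩ʳ i'))
    glue-edge (edge-child i' {u} {v} e) =
      edge-child (σ ⟨$⟩ʳ i') (Equivalence.to (Iso.preserves-edges i' u v) e)

    glue-edge⁻¹ : ∀ u v → Edge (node c ts) (glue u) (glue v) → Edge (node c' ts') u v
    glue-edge⁻¹ here         (child j' q) e =
      subst (Edge (node c' ts') here ∘ child j') (sym q≡here) (edge-here j')
      where
      q≡here : q ≡ here
      q≡here = Iso.injective j' (trans (edge-here⁻¹ e) (sym (Iso.root j')))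
    glue-edge⁻¹ (child i' p) (child j' q) e with permutation-injective σ (edge-child-index e)
    ... | refl = edge-child i' (Equivalence.from (Iso.preserves-edges i' p q) (edge-child⁻¹ e))

    glue-colour : ∀ v → colour (node c ts) (glue v) ≡ colour (node c' ts') v
    glue-colour here         = c≡c'
    glue-colour (child i' p) = Iso.preserves-colour i' p

    glue-isColIso : IsColIso (node c' ts') (node c ts) glue
    glue-isColIso = (glue-injective , strictlySurjective⇒surjective glue-surjective) ,
                    (λ u v → mk⇔ glue-edge (glue-edge⁻¹ u v)) ,
                    glue-colour

  glue-preorder : ∀ {pos pos' sb sb'} →
    (∀ i' → toℕ (pos ⟨$⟩ʳ (σ ⟨$⟩ʳ i')) ≡ toℕ (pos' ⟨$⟩ʳ i')) →
    (∀ i' → size (lookup ts (σ ⟨$⟩ʳ i')) ≡ size (lookup ts' i')) →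
    (∀ i' p → preorder _ (sb (σ ⟨$⟩ʳ i')) (fs i' p) ≡ preorder _ (sb' i') p) →
    ∀ v → preorder (node c ts) (arr pos sb) (glue v) ≡ preorder (node c' ts') (arr pos' sb') v
  glue-preorder _       _        _   here         = refl
  glue-preorder {pos} {pos'} pos∘σ≗pos' size∘σ≗size preorder∘fs≗preorder (child i' p) =
    cong suc (cong₂ _+_ (offset-reindex {ts} {ts'} {pos} {pos'} σ pos∘σ≗pos' size∘σ≗size i')
                        (preorder∘fs≗preorder i' p))

-- LD orderings are canonical

PreorderIso : (T : Arb) → Arrangement T → (T' : Arb) → Arrangement T' → Set
PreorderIso T a T' a' =
  Σ (Pos T' → Pos T) λ f → IsColIso T' T f × (∀ v → preorder T a (f v) ≡ preorder T' a' v)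

record ChildMatching (ts ts' : List Arb) (pos : Permutation′ (length ts))
                     (pos' : Permutation′ (length ts')) : Set where
  field
    σ          : Permutation (length ts') (length ts)
    key∘σ≗key  : ∀ i' → key (lookup ts (σ ⟨$⟩ʳ i')) ≡ key (lookup ts' i')
    pos∘σ≗pos' : ∀ i' → toℕ (pos ⟨$⟩ʳ (σ ⟨$⟩ʳ i')) ≡ toℕ (pos' ⟨$⟩ʳ i')

LD-children-match : ∀ {ts ts'} {pos : Permutation′ (length ts)} {pos' : Permutation′ (length ts')} →
  Ranks (key ∘ lookup ts) pos → Ranks (key ∘ lookup ts') pos' →
  sortKeys (keysOf ts) ≡ sortKeys (keysOf ts') → ChildMatching ts ts' pos pos'
LD-children-match {ts} {ts'} {pos} {pos'} ranks ranks' sorted≡ =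
  let σ , key∘σ≗key , pos∘σ≗pos' = align (key ∘ lookup ts) (key ∘ lookup ts') pos pos' visits≡
  in record { σ = σ ; key∘σ≗key = key∘σ≗key ; pos∘σ≗pos' = pos∘σ≗pos' }
  where
  open ≡-Reasoning
  visits≡ : tabulate (key ∘ lookup ts ∘ (pos ⟨$⟩ˡ_)) ≡ tabulate (key ∘ lookup ts' ∘ (pos' ⟨$⟩ˡ_))
  visits≡ = begin
    tabulate (key ∘ lookup ts ∘ (pos ⟨$⟩ˡ_))     ≡⟨ ranks⇒≡sortKeys _ pos ranks ⟩
    sortKeys (tabulate (key ∘ lookup ts))       ≡⟨ cong sortKeys (keysOf≡tabulate ts) ⟨
    sortKeys (keysOf ts)                        ≡⟨ sorted≡ ⟩
    sortKeys (keysOf ts')                       ≡⟨ cong sortKeys (keysOf≡tabulate ts') ⟩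
    sortKeys (tabulate (key ∘ lookup ts'))      ≡⟨ ranks⇒≡sortKeys _ pos' ranks' ⟨
    tabulate (key ∘ lookup ts' ∘ (pos' ⟨$⟩ˡ_))   ∎

LDSorted⇒PreorderIso : ∀ {T T'} (a : Arrangement T) (a' : Arrangement T') →
  LDSorted T a → LDSorted T' a' → key T ≡ key T' → PreorderIso T a T' a'
LDSorted⇒PreorderIso {node c ts} {node c' ts'} (arr pos sb) (arr pos' sb')
                     (ranks , sorted) (ranks' , sorted') key≡ =
  glue , glue-isColIso (cong proj₁ key≡) (proj₁ ∘ proj₂ ∘ subIso) ,
  glue-preorder pos∘σ≗pos' (key-size ∘ key∘σ≗key) (proj₂ ∘ proj₂ ∘ subIso)
  where
  sorted≡ : sortKeys (keysOf ts) ≡ sortKeys (keysOf ts')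
  sorted≡ =
    assemble-injective (sortedKeysOf-readable ts) (sortedKeysOf-readable ts') (cong proj₂ key≡)

  open ChildMatching (LD-children-match {ts} {ts'} {pos} {pos'} ranks ranks' sorted≡)

  subIso : ∀ i' → PreorderIso _ (sb (σ ⟨$⟩ʳ i')) _ (sb' i')
  subIso i' = LDSorted⇒PreorderIso (sb (σ ⟨$⟩ʳ i')) (sb' i') (sorted _) (sorted' i') (key∘σ≗key i')

  open Glue {c} {c'} {ts} {ts'} σ (proj₁ ∘ subIso)

LDLabelings⇒InvComposeIsIso : ∀ {T T' φ φ'} → IsLDLabeling T φ → IsLDLabeling T' φ' →
                              key T ≡ key T' → InvComposeIsIso T T' φ φ'
LDLabelings⇒InvComposeIsIso (a , sorted , φ≗) (a' , sorted' , φ'≗) key≡ =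
  let f , f-iso , f-preorder = LDSorted⇒PreorderIso a a' sorted sorted' key≡
  in f , (λ v → trans (φ≗ (f v)) (trans (f-preorder v) (sym (φ'≗ v)))) , f-iso

corollary3p8 : (T T' : Arb) (φ : Pos T → ℕ) (φ' : Pos T' → ℕ) →
    IsLDLabeling T φ → IsLDLabeling T' φ' →
    (Isomorphic T T' ⇔ (InvComposeIsIso T T' φ φ' × InvComposeIsIso T' T φ' φ))
corollary3p8 T T' φ φ' ld ld' = mk⇔ iso⇒compositions compositions⇒iso
  where
  iso⇒compositions : Isomorphic T T' → InvComposeIsIso T T' φ φ' × InvComposeIsIso T' T φ' φ
  iso⇒compositions iso = LDLabelings⇒InvComposeIsIso ld ld' (iso⇒key≡ iso) ,
                         LDLabelings⇒InvComposeIsIso ld' ld (sym (iso⇒key≡ iso))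

  compositions⇒iso : InvComposeIsIso T T' φ φ' × InvComposeIsIso T' T φ' φ → Isomorphic T T'
  compositions⇒iso (_ , (g , _ , g-iso)) = g , g-iso
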